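{- Let $p<q$ be prime numbers with $q=p+s$ for some $s\in\{1,\ldots,p-1\}$ (i.e. $p<q<2p$), and let $N=pq$. Let $\beta\in\mathbb{Z}$ with $\beta\neq p+q-1$, $\gcd(p,\beta)=1$ and $\gcd(pq,p+q-\beta)=1$. Then $\beta\in\mathbb{Z}\text{ - }\mathcal{KS}(N)$ if and only if $\frac{qp}{p+q-\beta}\in(\mathbb{Q}\setminus\mathbb{Z})\text{ - }\mathcal{KS}(N)$.
   Context: For a rational number $\alpha\neq 0$ write $\alpha=\frac{\alpha_1}{\alpha_2}$ with $\alpha_1,\alpha_2$ integers and $\gcd(\alpha_1,\alpha_2)=1$. An integer $N\ge 2$ is called an $\alpha$-Korselt number if $N\neq\alpha$ and $\alpha_2 r-\alpha_1$ divides $\alpha_2 N-\alpha_1$ (in $\mathbb{Z}$; $0$ divides only $0$) for every prime divisor $r$ of $N$. For a subset $\mathbb{A}\subseteq\mathbb{Q}$, $\mathbb{A}\text{ - }\mathcal{KS}(N)$ denotes the set of all $\beta\in\mathbb{A}\setminus\{0,N\}$ such that $N$ is a $\beta$-Korselt number. -}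

module Defs where

open import Data.Nat as ℕ using (ℕ; suc; _≥_)
open import Data.Nat.Divisibility using (_∣_)
open import Data.Nat.Primality using (Prime)
open import Data.Integer as ℤ using (ℤ; +_; -[1+_]; _-_; -_)
open import Data.Integer.Divisibility as ℤD using ()
open import Data.Rational using (ℚ; ↥_; ↧_; _/_; 0ℚ)
open import Data.Product using (_×_; ∃)
open import Relation.Nullary using (¬_)
open import Relation.Binary.PropositionalEquality using (_≡_)

ℕ→ℚ : ℕ → ℚ
ℕ→ℚ n = + n / 1

ℤ→ℚ : ℤ → ℚ
ℤ→ℚ z = z / 1

-- The rational a / b for integers a, b (b ≠ 0; value 0 if b = 0, never used).
_÷ℤ_ : ℤ → ℤ → ℚ
a ÷ℤ (+ 0)     = 0ℚ
a ÷ℤ (+ suc n) = a / suc n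
a ÷ℤ -[1+ n ]  = (- a) / suc n

-- α = α₁/α₂ in lowest terms (α₂ > 0, as stored in ℚ).
-- N is an α-Korselt number: N ≥ 2, N ≠ α, and for each prime r ∣ N,
-- (α₂ r − α₁) ∣ (α₂ N − α₁) in ℤ.
IsKorselt : ℚ → ℕ → Set
IsKorselt α N =
  (N ≥ 2) × (¬ (α ≡ ℕ→ℚ N)) ×
  (∀ r → Prime r → r ∣ N →
     ((↧ α) ℤ.* (+ r) - (↥ α)) ℤD.∣ ((↧ α) ℤ.* (+ N) - (↥ α)))

IsInteger : ℚ → Set
IsInteger α = ∃ λ (z : ℤ) → α ≡ ℤ→ℚ z

-- β ∈ A-KS(N), with A given as a predicate on ℚ:
-- β ∈ A, β ≠ 0, β ≠ N, and N is β-Korselt.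
InKS : (ℚ → Set) → ℕ → ℚ → Set
InKS A N β = A β × ¬ (β ≡ 0ℚ) × ¬ (β ≡ ℕ→ℚ N) × IsKorselt β N

module Submission where

open import Defs
open import Data.Nat using (ℕ; _<_; _*_; _+_)
open import Data.Nat.Primality using (Prime)
open import Data.Integer using (ℤ; +_; _-_)
open import Data.Integer.GCD using (gcd)
open import Data.Product using (_×_)
open import Function.Bundles using (_⇔_)
open import Relation.Nullary using (¬_)
open import Relation.Binary.PropositionalEquality using (_≡_)

-- Notation: b = β, d = p + q − β and γ = qp/d.  The proof reduces both sides
-- of the equivalence to the same pair of divisibilities
--     Kp : (p − β) ∣ (q − 1)        Kq : (q − β) ∣ (p − 1).
-- (1) Since gcd(qp, d) = 1, the reduced numerator and denominator of γ are
--     ±qp and ±d, so the Korselt condition of N = pq at a prime r is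
--     (d·r − pq) ∣ (d·pq − pq) for γ and (r − β) ∣ (pq − β) for β.
-- (2) Writing N = R·S with {R, S} = {p, q}, elementary algebra turns the
--     β-condition at R into (R − β) ∣ (S − 1) when gcd(R − β, R) = 1, and the
--     γ-condition at R into (R − β) ∣ (S − 1) when gcd(R − β, S) = 1.  The
--     needed coprimalities follow from gcd(p, β) = 1 and gcd(pq, d) = 1, except
--     gcd(q − β, q) = 1, i.e. q ∤ β, which is deduced from Kp by a size argument.
-- (3) The remaining side conditions: β ≠ 0, pq because p ∤ β; γ ≠ 0; and γ is
--     not an integer, since d = 1 is excluded and d = −1 contradicts Kq.

open import Data.Nat as ℕ using (suc; zero; s≤s)
import Data.Nat.Properties as ℕP
import Data.Nat.Divisibility as ℕD
import Data.Nat.Coprimality as ℕC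
import Data.Nat.GCD as ℕG
open import Data.Nat.Primality using (prime⇒irreducible; prime⇒nonTrivial; prime⇒nonZero; euclidsLemma)
open import Data.Integer as ℤ using (-[1+_]; -_; 0ℤ; 1ℤ; -1ℤ)
import Data.Integer.Properties as ℤP
import Data.Integer.GCD as ℤGCD
import Data.Integer.Divisibility as ℤD
import Data.Integer.Coprimality as ℤC
open import Data.Integer.Divisibility.Signed
open import Data.Integer.Tactic.RingSolver using (solve-∀)
open import Data.Rational using (ℚ; ↥_; ↧_; _/_; 0ℚ)
import Data.Rational.Properties as ℚP
open import Data.Empty using (⊥; ⊥-elim)
open import Data.Sum using (_⊎_; inj₁; inj₂)
open import Data.Product using (_,_; proj₁; proj₂)
open import Function.Base using (id)
open import Function.Bundles using (mk⇔; Equivalence)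
open import Function.Properties.Equivalence using (⇔-setoid)
open import Level using (0ℓ)
open import Relation.Binary.PropositionalEquality
  using (refl; sym; trans; cong; cong₂; subst; subst₂; module ≡-Reasoning)

import Relation.Binary.Reasoning.Setoid as SetoidReasoning

open Equivalence using (to; from)
module ⇔-Reasoning = SetoidReasoning (⇔-setoid 0ℓ)


coprime-inherit : ∀ {a x} y → (∀ c → c ∣ a → c ∣ y → c ∣ x) →
  ℤC.Coprime a x → ℤC.Coprime a y
coprime-inherit _ common a⊥x (c∣a , c∣y) =
  a⊥x (c∣a , ∣⇒∣ᵤ (common (+ _) (∣ᵤ⇒∣ c∣a) (∣ᵤ⇒∣ c∣y)))

coprime-factor : ∀ x s y → ℤC.Coprime x s → (x ∣ s ℤ.* y) ⇔ (x ∣ y)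
coprime-factor x s y x⊥s =
  mk⇔ (λ x∣sy → ∣ᵤ⇒∣ (ℤC.coprime-divisor x s y x⊥s (∣⇒∣ᵤ x∣sy))) (∣n⇒∣m*n s)

divides-modulo : ∀ {x} u v → x ∣ v → (x ∣ u ℤ.+ v) ⇔ (x ∣ u)
divides-modulo u v x∣v = mk⇔ (λ h → ∣m+n∣n⇒∣m h x∣v) (λ h → ∣m∣n⇒∣m+n h x∣v)

negated-divisibility : ∀ x y → ((- x) ℤD.∣ (- y)) ⇔ (x ∣ y)
negated-divisibility x y = mk⇔ (λ h → ∣ᵤ⇒∣ (subst id same h)) (λ h → subst id (sym same) (∣⇒∣ᵤ h))
  where
  same : ((- x) ℤD.∣ (- y)) ≡ (x ℤD.∣ y)
  same = cong₂ ℕD._∣_ (ℤP.∣-i∣≡∣i∣ x) (ℤP.∣-i∣≡∣i∣ y)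

divisor-of-pred-bound : ∀ {x q} → 1 < q → x ∣ (+ q - 1ℤ) → ℤ.∣ x ∣ < q
divisor-of-pred-bound {q = suc (suc q)} _         x∣q-1 = s≤s (ℕD.∣⇒≤ (∣⇒∣ᵤ x∣q-1))
divisor-of-pred-bound {q = suc zero}    (s≤s ()) _

sub-sub : ∀ x y → x - (x - y) ≡ y
sub-sub = solve-∀

abs-cases : ∀ b {n} → ℤ.∣ b ∣ ≡ n → b ≡ + n ⊎ b ≡ - + n
abs-cases (+ _)    refl = inj₁ refl
abs-cases -[1+ _ ] refl = inj₂ refl


KorseltAt : ℚ → ℕ → ℕ → Set
KorseltAt α N r = ((↧ α) ℤ.* (+ r) - (↥ α)) ℤD.∣ ((↧ α) ℤ.* (+ N) - (↥ α))

data ReducedForm (γ : ℚ) (a d : ℤ) : Set where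
  exactly : ↥ γ ≡ a   → ↧ γ ≡ d   → ReducedForm γ a d
  negated : ↥ γ ≡ - a → ↧ γ ≡ - d → ReducedForm γ a d

/-reduced : ∀ i n .{{_ : ℕ.NonZero n}} → gcd i (+ n) ≡ 1ℤ →
  ↥ (i / n) ≡ i × ↧ (i / n) ≡ + n
/-reduced i n gcd≡1 = cancel-gcd (ℚP.↥-/ i n) , cancel-gcd (ℚP.↧-/ i n)
  where
  cancel-gcd : ∀ {x y} → x ℤ.* gcd i (+ n) ≡ y → x ≡ y
  cancel-gcd {x} {y} eq = trans (sym (ℤP.*-identityʳ x)) (subst (λ g → x ℤ.* g ≡ y) gcd≡1 eq)

ℤ→ℚ-reduced : ∀ z → ↥ (ℤ→ℚ z) ≡ z × ↧ (ℤ→ℚ z) ≡ 1ℤ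
ℤ→ℚ-reduced z = /-reduced z 1 (ℤGCD.gcd-zeroʳ z)

ℤ→ℚ-injective : ∀ {x y} → ℤ→ℚ x ≡ ℤ→ℚ y → x ≡ y
ℤ→ℚ-injective {x} {y} eq =
  trans (sym (proj₁ (ℤ→ℚ-reduced x))) (trans (cong ↥_ eq) (proj₁ (ℤ→ℚ-reduced y)))

÷ℤ-reduced : ∀ a d → ¬ (d ≡ 0ℤ) → gcd a d ≡ 1ℤ → ReducedForm (a ÷ℤ d) a d
÷ℤ-reduced a (+ zero)   d≢0 _     = ⊥-elim (d≢0 refl)
÷ℤ-reduced a (+ suc n)  _   gcd≡1 = exactly (proj₁ form) (proj₂ form)
  where
  form : ↥ (a / suc n) ≡ a × ↧ (a / suc n) ≡ + suc n
  form = /-reduced a (suc n) gcd≡1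
÷ℤ-reduced a -[1+ n ]   _   gcd≡1 = negated (proj₁ form) (proj₂ form)
  where
  form : ↥ ((- a) / suc n) ≡ - a × ↧ ((- a) / suc n) ≡ + suc n
  form = /-reduced (- a) (suc n)
           (trans (cong (λ m → + ℕG.gcd m (suc n)) (ℤP.∣-i∣≡∣i∣ a)) gcd≡1)

numerator-abs : ∀ {γ a d} → ReducedForm γ a d → ℤ.∣ ↥ γ ∣ ≡ ℤ.∣ a ∣
numerator-abs (exactly e _) = cong ℤ.∣_∣ e
numerator-abs {a = a} (negated e _) = trans (cong ℤ.∣_∣ e) (ℤP.∣-i∣≡∣i∣ a)

denominator-abs : ∀ {γ a d} → ReducedForm γ a d → ℤ.∣ ↧ γ ∣ ≡ ℤ.∣ d ∣
denominator-abs (exactly _ e) = cong ℤ.∣_∣ e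
denominator-abs {d = d} (negated _ e) = trans (cong ℤ.∣_∣ e) (ℤP.∣-i∣≡∣i∣ d)

korselt-reduced : ∀ {γ a d} → ReducedForm γ a d → ∀ N r →
  KorseltAt γ N r ⇔ ((d ℤ.* + r - a) ∣ (d ℤ.* + N - a))
korselt-reduced {γ} {a} {d} (exactly e₁ e₂) N r = begin
  KorseltAt γ N r                            ≡⟨ cong₂ ℤD._∣_ (shape (+ r)) (shape (+ N)) ⟩
  (d ℤ.* + r - a) ℤD.∣ (d ℤ.* + N - a)       ≈⟨ mk⇔ ∣ᵤ⇒∣ ∣⇒∣ᵤ ⟩
  (d ℤ.* + r - a) ∣ (d ℤ.* + N - a)          ∎
  where
  open ⇔-Reasoning
  shape : ∀ x → ↧ γ ℤ.* x - ↥ γ ≡ d ℤ.* x - a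
  shape x = cong₂ (λ u v → u ℤ.* x - v) e₂ e₁
korselt-reduced {γ} {a} {d} (negated e₁ e₂) N r = begin
  KorseltAt γ N r                            ≡⟨ cong₂ ℤD._∣_ (shape (+ r)) (shape (+ N)) ⟩
  (- (d ℤ.* + r - a)) ℤD.∣ (- (d ℤ.* + N - a)) ≈⟨ negated-divisibility _ _ ⟩
  (d ℤ.* + r - a) ∣ (d ℤ.* + N - a)          ∎
  where
  open ⇔-Reasoning
  flip-sign : ∀ d x a → (- d) ℤ.* x - (- a) ≡ - (d ℤ.* x - a)
  flip-sign = solve-∀
  shape : ∀ x → ↧ γ ℤ.* x - ↥ γ ≡ - (d ℤ.* x - a)
  shape x = trans (cong₂ (λ u v → u ℤ.* x - v) e₂ e₁) (flip-sign d x a)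

korselt-integer : ∀ z N r → KorseltAt (ℤ→ℚ z) N r ⇔ ((+ r - z) ∣ (+ N - z))
korselt-integer z N r =
  subst₂ (λ x y → KorseltAt (ℤ→ℚ z) N r ⇔ ((x - z) ∣ (y - z)))
    (ℤP.*-identityˡ (+ r)) (ℤP.*-identityˡ (+ N))
    (korselt-reduced {ℤ→ℚ z} (exactly num den) N r)
  where
  num : ↥ (ℤ→ℚ z) ≡ z
  num = proj₁ (ℤ→ℚ-reduced z)
  den : ↧ (ℤ→ℚ z) ≡ 1ℤ
  den = proj₂ (ℤ→ℚ-reduced z)


-- Integer case: (R − b) ∣ (R·S − b) reduces to (R − b) ∣ (S − 1) when
-- gcd(R − b, R) = 1, because R·S − b = R·(S − 1) + (R − b).
integer-condition : ∀ R S N b → N ≡ R ℤ.* S → ℤC.Coprime (R - b) R →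
  ((R - b) ∣ (N - b)) ⇔ ((R - b) ∣ (S - 1ℤ))
integer-condition R S _ b refl R-b⊥R = begin
  (R - b) ∣ (R ℤ.* S - b)                   ≡⟨ cong ((R - b) ∣_) (split R S b) ⟩
  (R - b) ∣ (R ℤ.* (S - 1ℤ) ℤ.+ (R - b))    ≈⟨ divides-modulo _ _ ∣-refl ⟩
  (R - b) ∣ (R ℤ.* (S - 1ℤ))                ≈⟨ coprime-factor (R - b) R _ R-b⊥R ⟩
  (R - b) ∣ (S - 1ℤ)                        ∎
  where
  open ⇔-Reasoning
  split : ∀ R S b → R ℤ.* S - b ≡ R ℤ.* (S - 1ℤ) ℤ.+ (R - b)
  split = solve-∀

-- Fraction case: for D = K + S and A = M = R·S with R ≠ 0,
-- (D·R − A) ∣ (D·M − A) reduces to K ∣ (S − 1) when gcd(K, S) = 1, because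
-- D·R − A = R·K and D·M − A = R·(S·(S − 1) + S·K).
fraction-condition : ∀ R S K D A M .{{_ : ℤ.NonZero R}} →
  D ≡ K ℤ.+ S → A ≡ R ℤ.* S → M ≡ R ℤ.* S → ℤC.Coprime K S →
  ((D ℤ.* R - A) ∣ (D ℤ.* M - A)) ⇔ (K ∣ (S - 1ℤ))
fraction-condition R S K _ _ _ refl refl refl K⊥S = begin
  (D ℤ.* R - R ℤ.* S) ∣ (D ℤ.* (R ℤ.* S) - R ℤ.* S)
    ≡⟨ cong₂ _∣_ (left R S K) (right R S K) ⟩
  (R ℤ.* K) ∣ (R ℤ.* (S ℤ.* (S - 1ℤ) ℤ.+ S ℤ.* K))
    ≈⟨ mk⇔ (*-cancelˡ-∣ R) (*-monoʳ-∣ R) ⟩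
  K ∣ (S ℤ.* (S - 1ℤ) ℤ.+ S ℤ.* K)
    ≈⟨ divides-modulo _ _ (∣n⇒∣m*n S ∣-refl) ⟩
  K ∣ (S ℤ.* (S - 1ℤ))
    ≈⟨ coprime-factor K S _ K⊥S ⟩
  K ∣ (S - 1ℤ)
    ∎
  where
  open ⇔-Reasoning
  D : ℤ
  D = K ℤ.+ S
  left : ∀ R S K → (K ℤ.+ S) ℤ.* R - R ℤ.* S ≡ R ℤ.* K
  left = solve-∀
  right : ∀ R S K → (K ℤ.+ S) ℤ.* (R ℤ.* S) - R ℤ.* S ≡ R ℤ.* (S ℤ.* (S - 1ℤ) ℤ.+ S ℤ.* K)
  right = solve-∀


prime>1 : ∀ {p} → Prime p → 1 < p
prime>1 {p} p-prime = ℕ.nonTrivial⇒n>1 p {{prime⇒nonTrivial p-prime}}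

coprime⇒∤ : ∀ {n m} → 1 < n → ℕC.Coprime n m → ¬ (n ℕD.∣ m)
coprime⇒∤ 1<n n⊥m n∣m = ℕP.<-irrefl (sym (n⊥m (ℕD.∣-refl , n∣m))) 1<n

prime-coprime : ∀ {q} x → Prime q → ¬ (+ q ∣ x) → ℤC.Coprime x (+ q)
prime-coprime x q-prime q∤x {c} (c∣x , c∣q) with prime⇒irreducible q-prime c∣q
... | inj₁ c≡1 = c≡1
... | inj₂ refl = ⊥-elim (q∤x (∣ᵤ⇒∣ c∣x))

prime-divisor-of-prime : ∀ {p r} → Prime p → Prime r → r ℕD.∣ p → r ≡ p
prime-divisor-of-prime p-prime r-prime r∣p with prime⇒irreducible p-prime r∣p
... | inj₁ refl = ⊥-elim (ℕP.<-irrefl refl (prime>1 r-prime))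
... | inj₂ r≡p  = r≡p

prime-divisor-of-product : ∀ {p q r} → Prime p → Prime q → Prime r →
  r ℕD.∣ p * q → r ≡ p ⊎ r ≡ q
prime-divisor-of-product {p} {q} p-prime q-prime r-prime r∣pq
  with euclidsLemma p q r-prime r∣pq
... | inj₁ r∣p = inj₁ (prime-divisor-of-prime p-prime r-prime r∣p)
... | inj₂ r∣q = inj₂ (prime-divisor-of-prime q-prime r-prime r∣q)

at-prime-divisors : ∀ {p q} (C : ℕ → Set) → Prime p → Prime q → C p → C q →
  ∀ r → Prime r → r ℕD.∣ p * q → C r
at-prime-divisors C p-prime q-prime Cp Cq r r-prime r∣pq
  with prime-divisor-of-product p-prime q-prime r-prime r∣pq
... | inj₁ refl = Cp
... | inj₂ refl = Cq

multiple-below-double : ∀ {m n} → m ℕD.∣ n → ¬ (n ≡ 0) → n < m + m → n ≡ m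
multiple-below-double (ℕD.divides zero refl) n≢0 _ = ⊥-elim (n≢0 refl)
multiple-below-double {m} (ℕD.divides 1 refl) _ _ = ℕP.+-identityʳ m
multiple-below-double {m} (ℕD.divides (suc (suc k)) refl) _ n<2m =
  ⊥-elim (ℕP.<⇒≱ n<2m (ℕP.+-monoʳ-≤ m (ℕP.m≤m+n m (k * m))))

small-if-divides-pred : ∀ {p q} b → 0 < p → p < q → (+ p - b) ∣ (+ q - 1ℤ) →
  ℤ.∣ b ∣ < q + q
small-if-divides-pred {p} {q} b 0<p p<q p-b∣q-1 = begin-strict
  ℤ.∣ b ∣                   ≡⟨ cong ℤ.∣_∣ (sym (sub-sub (+ p) b)) ⟩
  ℤ.∣ + p - (+ p - b) ∣     ≤⟨ ℤP.∣i-j∣≤∣i∣+∣j∣ (+ p) (+ p - b) ⟩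
  p + ℤ.∣ + p - b ∣         <⟨ ℕP.+-monoʳ-< p (divisor-of-pred-bound 1<q p-b∣q-1) ⟩
  p + q                     ≤⟨ ℕP.+-monoˡ-≤ q (ℕP.<⇒≤ p<q) ⟩
  q + q                     ∎
  where
  open ℕP.≤-Reasoning
  1<q : 1 < q
  1<q = ℕP.≤-<-trans 0<p p<q

-- The size argument behind gcd(q − β, q) = 1: under 1 < p < q, gcd(p, b) = 1
-- and gcd(pq, p + q − b) = 1, the divisibility (p − b) ∣ (q − 1) forces q ∤ b.
-- Otherwise |b| = q by the bounds above; b = q makes p + q − b = p share the
-- factor p with pq, and b = −q makes p − b = p + q too large to divide q − 1.
q∤b : ∀ {p q} b → 1 < p → p < q → ℕC.Coprime p ℤ.∣ b ∣ →
  ℕC.Coprime (p * q) ℤ.∣ + (p + q) - b ∣ → (+ p - b) ∣ (+ q - 1ℤ) → ¬ (+ q ∣ b)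
q∤b {p} {q} b 1<p p<q p⊥b pq⊥d p-b∣q-1 q∣b = excluded (abs-cases b |b|≡q)
  where
  |b|≢0 : ¬ (ℤ.∣ b ∣ ≡ 0)
  |b|≢0 |b|≡0 = coprime⇒∤ 1<p p⊥b (subst (p ℕD.∣_) (sym |b|≡0) (p ℕD.∣0))
  |b|≡q : ℤ.∣ b ∣ ≡ q
  |b|≡q = multiple-below-double (∣⇒∣ᵤ q∣b) |b|≢0
            (small-if-divides-pred b (ℕP.<⇒≤ 1<p) p<q p-b∣q-1)
  cancel : ∀ P Q → P ℤ.+ Q - Q ≡ P
  cancel = solve-∀
  subtract-negative : ∀ P Q → P - (- Q) ≡ P ℤ.+ Q
  subtract-negative = solve-∀
  excluded : b ≡ + q ⊎ b ≡ - + q → ⊥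
  excluded (inj₁ b≡q) = coprime⇒∤ 1<p (ℕC.sym (subst (ℕC.Coprime (p * q)) d≡p pq⊥d)) (ℕD.m∣m*n q)
    where
    d≡p : ℤ.∣ + (p + q) - b ∣ ≡ p
    d≡p = cong ℤ.∣_∣ (trans (cong (λ x → + (p + q) - x) b≡q) (cancel (+ p) (+ q)))
  excluded (inj₂ b≡-q) = ℕP.<⇒≱ (subst (_< q) p-b≡p+q (divisor-of-pred-bound 1<q p-b∣q-1)) (ℕP.m≤n+m q p)
    where
    1<q : 1 < q
    1<q = ℕP.<-trans 1<p p<q
    p-b≡p+q : ℤ.∣ + p - b ∣ ≡ p + q
    p-b≡p+q = cong ℤ.∣_∣ (trans (cong (λ x → + p - x) b≡-q) (subtract-negative (+ p) (+ q)))


module Setting {p q : ℕ} (p-prime : Prime p) (q-prime : Prime q) (p<q : p < q)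
  (b : ℤ) (gcd[p,b]≡1 : gcd (+ p) b ≡ 1ℤ) (gcd[pq,d]≡1 : gcd (+ (p * q)) (+ (p + q) - b) ≡ 1ℤ)
  where

  d : ℤ
  d = + (p + q) - b

  γ : ℚ
  γ = (+ (q * p)) ÷ℤ d

  Kp Kq : Set
  Kp = (+ p - b) ∣ (+ q - 1ℤ)
  Kq = (+ q - b) ∣ (+ p - 1ℤ)

  1<p : 1 < p
  1<p = prime>1 p-prime

  instance
    p≢0 : ℕ.NonZero p
    p≢0 = prime⇒nonZero p-prime
    q≢0 : ℕ.NonZero q
    q≢0 = prime⇒nonZero q-prime

  p⊥b : ℕC.Coprime p ℤ.∣ b ∣
  p⊥b = ℕC.gcd≡1⇒coprime (ℤP.+-injective gcd[p,b]≡1)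

  pq⊥d : ℕC.Coprime (p * q) ℤ.∣ d ∣
  pq⊥d = ℕC.gcd≡1⇒coprime (ℤP.+-injective gcd[pq,d]≡1)

  p⊥d : ℤC.Coprime (+ p) d
  p⊥d (c∣p , c∣d) = pq⊥d (ℕD.∣-trans c∣p (ℕD.m∣m*n q) , c∣d)

  q⊥d : ℤC.Coprime (+ q) d
  q⊥d (c∣q , c∣d) = pq⊥d (ℕD.∣-trans c∣q (ℕD.n∣m*n p) , c∣d)

  d≡[p-b]+q : d ≡ (+ p - b) ℤ.+ + q
  d≡[p-b]+q = shift (+ p) (+ q) b
    where shift : ∀ P Q b → P ℤ.+ Q - b ≡ (P - b) ℤ.+ Q
          shift = solve-∀
  d≡[q-b]+p : d ≡ (+ q - b) ℤ.+ + p
  d≡[q-b]+p = shift (+ p) (+ q) b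
    where shift : ∀ P Q b → P ℤ.+ Q - b ≡ (Q - b) ℤ.+ P
          shift = solve-∀

  p-b⊥p : ℤC.Coprime (+ p - b) (+ p)
  p-b⊥p = ℤC.sym {+ p} {+ p - b} (coprime-inherit (+ p - b) divides-b p⊥b)
    where
    divides-b : ∀ c → c ∣ + p → c ∣ + p - b → c ∣ b
    divides-b c c∣p c∣p-b = subst (c ∣_) (sub-sub (+ p) b) (∣m∣n⇒∣m-n c∣p c∣p-b)

  p-b⊥q : ℤC.Coprime (+ p - b) (+ q)
  p-b⊥q = ℤC.sym {+ q} {+ p - b} (coprime-inherit (+ p - b) divides-d q⊥d)
    where
    divides-d : ∀ c → c ∣ + q → c ∣ + p - b → c ∣ d
    divides-d c c∣q c∣p-b = subst (c ∣_) (sym d≡[p-b]+q) (∣m∣n⇒∣m+n c∣p-b c∣q)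

  q-b⊥p : ℤC.Coprime (+ q - b) (+ p)
  q-b⊥p = ℤC.sym {+ p} {+ q - b} (coprime-inherit (+ q - b) divides-d p⊥d)
    where
    divides-d : ∀ c → c ∣ + p → c ∣ + q - b → c ∣ d
    divides-d c c∣p c∣q-b = subst (c ∣_) (sym d≡[q-b]+p) (∣m∣n⇒∣m+n c∣q-b c∣p)

  q-b⊥q : Kp → ℤC.Coprime (+ q - b) (+ q)
  q-b⊥q kp = prime-coprime (+ q - b) q-prime q∤q-b
    where
    q∤q-b : ¬ (+ q ∣ + q - b)
    q∤q-b q∣q-b = q∤b b 1<p p<q p⊥b pq⊥d kp
      (subst (+ q ∣_) (sub-sub (+ q) b) (∣m∣n⇒∣m-n ∣-refl q∣q-b))

  γ-form : ReducedForm γ (+ (q * p)) d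
  γ-form = ÷ℤ-reduced (+ (q * p)) d d≢0 gcd[qp,d]≡1
    where
    d≢0 : ¬ (d ≡ 0ℤ)
    d≢0 d≡0 = coprime⇒∤ 1<p p⊥d (subst (λ x → p ℕD.∣ ℤ.∣ x ∣) (sym d≡0) (p ℕD.∣0))
    gcd[qp,d]≡1 : gcd (+ (q * p)) d ≡ 1ℤ
    gcd[qp,d]≡1 = subst (λ n → gcd (+ n) d ≡ 1ℤ) (ℕP.*-comm p q) gcd[pq,d]≡1

  pq≡P*Q : + (p * q) ≡ + p ℤ.* + q
  pq≡P*Q = ℤP.pos-* p q

  qp≡Q*P : + (q * p) ≡ + q ℤ.* + p
  qp≡Q*P = ℤP.pos-* q p

  pq≡Q*P : + (p * q) ≡ + q ℤ.* + p
  pq≡Q*P = trans (cong +_ (ℕP.*-comm p q)) qp≡Q*P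

  qp≡P*Q : + (q * p) ≡ + p ℤ.* + q
  qp≡P*Q = trans (cong +_ (ℕP.*-comm q p)) pq≡P*Q

  β-at-p : KorseltAt (ℤ→ℚ b) (p * q) p ⇔ Kp
  β-at-p = begin
    KorseltAt (ℤ→ℚ b) (p * q) p     ≈⟨ korselt-integer b (p * q) p ⟩
    (+ p - b) ∣ (+ (p * q) - b)      ≈⟨ integer-condition (+ p) (+ q) _ b pq≡P*Q p-b⊥p ⟩
    Kp                               ∎
    where open ⇔-Reasoning

  β-at-q : Kp → KorseltAt (ℤ→ℚ b) (p * q) q ⇔ Kq
  β-at-q kp = begin
    KorseltAt (ℤ→ℚ b) (p * q) q     ≈⟨ korselt-integer b (p * q) q ⟩
    (+ q - b) ∣ (+ (p * q) - b)      ≈⟨ integer-condition (+ q) (+ p) _ b pq≡Q*P (q-b⊥q kp) ⟩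
    Kq                               ∎
    where open ⇔-Reasoning

  γ-at-p : KorseltAt γ (p * q) p ⇔ Kp
  γ-at-p = begin
    KorseltAt γ (p * q) p
      ≈⟨ korselt-reduced γ-form (p * q) p ⟩
    (d ℤ.* + p - + (q * p)) ∣ (d ℤ.* + (p * q) - + (q * p))
      ≈⟨ fraction-condition (+ p) (+ q) (+ p - b) d _ _ d≡[p-b]+q qp≡P*Q pq≡P*Q p-b⊥q ⟩
    Kp
      ∎
    where open ⇔-Reasoning

  γ-at-q : KorseltAt γ (p * q) q ⇔ Kq
  γ-at-q = begin
    KorseltAt γ (p * q) q
      ≈⟨ korselt-reduced γ-form (p * q) q ⟩
    (d ℤ.* + q - + (q * p)) ∣ (d ℤ.* + (p * q) - + (q * p))
      ≈⟨ fraction-condition (+ q) (+ p) (+ q - b) d _ _ d≡[q-b]+p qp≡Q*P pq≡Q*P q-b⊥p ⟩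
    Kq
      ∎
    where open ⇔-Reasoning

  β≢multiple-of-p : ∀ x → p ℕD.∣ ℤ.∣ x ∣ → ¬ (ℤ→ℚ b ≡ ℤ→ℚ x)
  β≢multiple-of-p x p∣x β≡x =
    coprime⇒∤ 1<p p⊥b (subst (λ y → p ℕD.∣ ℤ.∣ y ∣) (sym (ℤ→ℚ-injective {b} {x} β≡x)) p∣x)

  γ≢0 : ¬ (γ ≡ 0ℚ)
  γ≢0 γ≡0 = ℕ.≢-nonZero⁻¹ (q * p) {{ℕP.m*n≢0 q p}}
    (trans (sym (numerator-abs γ-form)) (cong (λ x → ℤ.∣ ↥ x ∣) γ≡0))

  -- γ is not an integer: its denominator |d| = 1 would give d = 1, i.e.
  -- b = p + q − 1, or d = −1, i.e. q − b = −(1 + p), which cannot divide p − 1.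
  γ-not-integer : ¬ (b ≡ + (p + q) - + 1) → Kq → ¬ IsInteger γ
  γ-not-integer b≢p+q-1 kq (z , γ≡z) = excluded (abs-cases d |d|≡1)
    where
    |d|≡1 : ℤ.∣ d ∣ ≡ 1
    |d|≡1 = begin
      ℤ.∣ d ∣           ≡⟨ sym (denominator-abs γ-form) ⟩
      ℤ.∣ ↧ γ ∣         ≡⟨ cong (λ x → ℤ.∣ ↧ x ∣) γ≡z ⟩
      ℤ.∣ ↧ ℤ→ℚ z ∣     ≡⟨ cong ℤ.∣_∣ (proj₂ (ℤ→ℚ-reduced z)) ⟩
      1                 ∎
      where open ≡-Reasoning
    q-b-via-d : ∀ P Q b → Q - b ≡ (P ℤ.+ Q - b) - P
    q-b-via-d = solve-∀
    negate-sum : ∀ P → -1ℤ - P ≡ - (1ℤ ℤ.+ P)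
    negate-sum = solve-∀
    excluded : d ≡ + 1 ⊎ d ≡ - + 1 → ⊥
    excluded (inj₁ d≡1) = b≢p+q-1 (trans (sym (sub-sub (+ (p + q)) b)) (cong (λ x → + (p + q) - x) d≡1))
    excluded (inj₂ d≡-1) = ℕP.<⇒≱ (divisor-of-pred-bound 1<p (subst (_∣ (+ p - 1ℤ)) q-b≡-[1+p] kq)) (ℕP.n≤1+n p)
      where
      q-b≡-[1+p] : + q - b ≡ - + suc p
      q-b≡-[1+p] = trans (q-b-via-d (+ p) (+ q) b) (trans (cong (_- + p) d≡-1) (negate-sum (+ p)))

proposition4p1 : (p q : ℕ) → Prime p → Prime q → p < q → q < p + p →
    (β : ℤ) → ¬ (β ≡ + (p + q) - + 1) →
    gcd (+ p) β ≡ + 1 → gcd (+ (p * q)) (+ (p + q) - β) ≡ + 1 →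
    InKS IsInteger (p * q) (ℤ→ℚ β)
      ⇔ InKS (λ γ → ¬ IsInteger γ) (p * q) ((+ (q * p)) ÷ℤ (+ (p + q) - β))
proposition4p1 p q p-prime q-prime p<q _ β β≢p+q-1 gcd[p,β]≡1 gcd[pq,d]≡1 = mk⇔ forward backward
  where
  open Setting p-prime q-prime p<q β gcd[p,β]≡1 gcd[pq,d]≡1
  p∣pq : p ℕD.∣ p * q
  p∣pq = ℕD.m∣m*n q
  q∣pq : q ℕD.∣ p * q
  q∣pq = ℕD.n∣m*n p

  forward : InKS IsInteger (p * q) (ℤ→ℚ β) → InKS (λ γ → ¬ IsInteger γ) (p * q) γ
  forward (_ , _ , _ , N≥2 , _ , korselt) = γ∉ℤ , γ≢0 , γ≢N , N≥2 , γ≢N , γ-korselt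
    where
    kp : Kp
    kp = to β-at-p (korselt p p-prime p∣pq)
    kq : Kq
    kq = to (β-at-q kp) (korselt q q-prime q∣pq)
    γ∉ℤ : ¬ IsInteger γ
    γ∉ℤ = γ-not-integer β≢p+q-1 kq
    γ≢N : ¬ (γ ≡ ℕ→ℚ (p * q))
    γ≢N γ≡N = γ∉ℤ (+ (p * q) , γ≡N)
    γ-korselt : ∀ r → Prime r → r ℕD.∣ p * q → KorseltAt γ (p * q) r
    γ-korselt = at-prime-divisors (KorseltAt γ (p * q)) p-prime q-prime (from γ-at-p kp) (from γ-at-q kq)

  backward : InKS (λ γ → ¬ IsInteger γ) (p * q) γ → InKS IsInteger (p * q) (ℤ→ℚ β)
  backward (_ , _ , _ , N≥2 , _ , korselt) = (β , refl) , β≢0 , β≢N , N≥2 , β≢N , β-korselt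
    where
    kp : Kp
    kp = to γ-at-p (korselt p p-prime p∣pq)
    kq : Kq
    kq = to γ-at-q (korselt q q-prime q∣pq)
    β≢0 : ¬ (ℤ→ℚ β ≡ 0ℚ)
    β≢0 = β≢multiple-of-p 0ℤ (p ℕD.∣0)
    β≢N : ¬ (ℤ→ℚ β ≡ ℕ→ℚ (p * q))
    β≢N = β≢multiple-of-p (+ (p * q)) p∣pq
    β-korselt : ∀ r → Prime r → r ℕD.∣ p * q → KorseltAt (ℤ→ℚ β) (p * q) r
    β-korselt = at-prime-divisors (KorseltAt (ℤ→ℚ β) (p * q)) p-prime q-prime
                  (from β-at-p kp) (from (β-at-q kp) kq)
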